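{- Let $\Sigma_{\mathrm U}=\Sigma_{\mathrm{UFD}}\cup\Sigma_{\mathrm{UID}}$ be a set of unary FDs and UIDs closed under finite implication, and let $P$ be a non-trivial SCC of $\Gamma(\Sigma_{\mathrm{UID}})$. For any two positions $R^i\neq R^j$ of $\mathrm{Pos}(P)$, if $R^i\to R^j$ is in $\Sigma_{\mathrm{UFD}}$ then so is $R^j\to R^i$.
   Context: A UID $R^p\subseteq S^q$ ($R^p\ne S^q$) says every element at $R^p$ occurs at $S^q$. A unary FD $R^i\to R^j$ says two $R$-facts agreeing on $R^i$ agree on $R^j$. Closed under finite implication: contains every UID and UFD satisfied by all finite instances satisfying $\Sigma_{\mathrm U}$. For $\tau:R^p\subseteq S^q$, $\tau':S^r\subseteq T^u$ in $\Sigma_{\mathrm{UID}}$, $\tau\rightarrowtail\tau'$ iff $S^r\neq S^q$ and $S^r\to S^q\in\Sigma_{\mathrm{UFD}}$. $\Gamma(\Sigma_{\mathrm{UID}})$ is the directed graph on $\Sigma_{\mathrm{UID}}$ with edges $\rightarrowtail$; an SCC is a maximal set $P$ with $\tau\rightarrowtail^*\tau'$ for all $\tau,\tau'\in P$; it is non-trivial unless it is a singleton $\{\tau\}$ with $\tau\not\rightarrowtail\tau$. $\mathrm{Pos}(P)$ is the set of positions occurring in UIDs of $P$. -}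

module Defs where

open import Data.Nat using (ℕ)
open import Data.Fin using (Fin)
open import Data.Vec using (Vec; lookup)
open import Data.List using (List)
open import Data.List.Membership.Propositional using (_∈_)
open import Data.Product using (Σ; _×_; _,_; ∃)
open import Data.Sum using (_⊎_)
open import Relation.Binary.PropositionalEquality using (_≡_; _≢_)
open import Relation.Binary.Construct.Closure.ReflexiveTransitive using (Star)

-- A finite relational schema: relation names Fin nR, each with an arity.
-- Elements of instances are natural numbers (any countably infinite domain
-- suffices for finite implication).
module Schema (nR : ℕ) (arity : Fin nR → ℕ) where

  record Pos : Set where
    constructor _^_
    field
      rel : Fin nR
      idx : Fin (arity rel)
  open Pos public

  Fact : Set
  Fact = Σ (Fin nR) (λ R → Vec ℕ (arity R))

  Instance : Set
  Instance = List Fact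

  -- A UID  src ⊆ tgt  (well-formedness src ≠ tgt is imposed separately).
  record UID : Set where
    constructor _⊆_
    field
      src : Pos
      tgt : Pos
  open UID public

  record UFD : Set where
    constructor fd
    field
      frel : Fin nR
      lhs  : Fin (arity frel)
      rhs  : Fin (arity frel)
  open UFD public

  lhsPos : UFD → Pos
  lhsPos φ = frel φ ^ lhs φ

  rhsPos : UFD → Pos
  rhsPos φ = frel φ ^ rhs φ

  SatUID : Instance → UID → Set
  SatUID I ((R ^ p) ⊆ (S ^ q)) =
    ∀ (t : Vec ℕ (arity R)) → (R , t) ∈ I →
      ∃ λ (u : Vec ℕ (arity S)) → ((S , u) ∈ I) × (lookup u q ≡ lookup t p)

  SatUFD : Instance → UFD → Set
  SatUFD I (fd R i j) =
    ∀ (t u : Vec ℕ (arity R)) → (R , t) ∈ I → (R , u) ∈ I →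
      lookup t i ≡ lookup u i → lookup t j ≡ lookup u j

  module Deps (ΣUID : UID → Set) (ΣUFD : UFD → Set) where

    WellFormed : Set
    WellFormed = ∀ τ → ΣUID τ → src τ ≢ tgt τ

    SatAll : Instance → Set
    SatAll I = (∀ τ → ΣUID τ → SatUID I τ) × (∀ φ → ΣUFD φ → SatUFD I φ)

    FinImpliesUID : UID → Set
    FinImpliesUID τ = ∀ (I : Instance) → SatAll I → SatUID I τ

    FinImpliesUFD : UFD → Set
    FinImpliesUFD φ = ∀ (I : Instance) → SatAll I → SatUFD I φ

    Closed : Set
    Closed = (∀ τ → src τ ≢ tgt τ → FinImpliesUID τ → ΣUID τ)
           × (∀ φ → FinImpliesUFD φ → ΣUFD φ)

    InUFD : Pos → Pos → Set
    InUFD a b = ∃ λ φ → ΣUFD φ × (lhsPos φ ≡ a) × (rhsPos φ ≡ b)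

    -- edge of Γ(Σ_UID): τ : R^p ⊆ S^q ↣ τ' : S^r ⊆ T^u
    -- iff S^r ≠ S^q and S^r → S^q ∈ Σ_UFD
    -- (the same relation S is forced by the UFD).
    Edge : UID → UID → Set
    Edge τ τ' = ΣUID τ × ΣUID τ' × (src τ' ≢ tgt τ) × InUFD (src τ') (tgt τ)

    Reach : UID → UID → Set
    Reach = Star Edge

    MutuallyReachable : (UID → Set) → Set
    MutuallyReachable Q = ∀ τ τ' → Q τ → Q τ' → Reach τ τ'

    IsSCC : (UID → Set) → Set₁
    IsSCC P = (∀ τ → P τ → ΣUID τ)
            × MutuallyReachable P
            × (∀ (Q : UID → Set) → (∀ τ → Q τ → ΣUID τ) → (∀ τ → P τ → Q τ)
                 → MutuallyReachable Q → ∀ τ → Q τ → P τ)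

    NonTrivial : (UID → Set) → Set
    NonTrivial P = ∀ τ → P τ → (∀ τ' → P τ' → τ' ≡ τ) → Edge τ τ

    InPos : (UID → Set) → Pos → Set
    InPos P a = ∃ λ τ → P τ × ((src τ ≡ a) ⊎ (tgt τ ≡ a))

-- The proof is a counting argument on finite instances.  For a finite
-- instance I and a position a, let card I a be the number of distinct values
-- occurring at a.  In every finite I satisfying Σ_U:
--   * a UID a ⊆ b gives card I a ≤ card I b (the values at a occur at b);
--   * a UFD a → b gives card I b ≤ card I a (the values at b are the image
--     of the values at a under the function the FD defines);
--   * hence card increases weakly along the edges of Γ(Σ_UID), and going
--     once around a non-trivial SCC P shows that all positions of Pos(P)
--     have the same card.
-- Now let R^i → R^j be in Σ_UFD with R^i, R^j in Pos(P).  The function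
-- mapping values at R^i onto values at R^j is a surjection between finite
-- sets of the same size, hence injective: every such I satisfies R^j → R^i.
-- As Σ_U is closed under finite implication, R^j → R^i is in Σ_UFD.

module Submission where

open import Defs
open import Data.Nat using (ℕ; suc; _≤_; z≤n; s≤s; _≤?_)
import Data.Nat as ℕ
open import Data.Nat.Properties using (≤-trans; ≤-antisym; ≤-refl; <-irrefl; module ≤-Reasoning)
open import Data.Fin using (Fin)
import Data.Fin as Fin
open import Data.Vec using (Vec; lookup)
open import Data.List using (List; []; _∷_; map; length; deduplicate)
open import Data.List.Properties using (length-map; length-removeAt′)
open import Data.List.Relation.Unary.Any using (here; there; index; any?)
open import Data.List.Relation.Unary.Any.Properties using (lookup-result)
import Data.List.Relation.Unary.Any as Any
import Data.List.Relation.Unary.All as All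
open import Data.List.Relation.Unary.AllPairs using (_∷_)
open import Data.List.Relation.Unary.Unique.Propositional using (Unique)
open import Data.List.Relation.Unary.Unique.DecPropositional.Properties using (deduplicate-!)
open import Data.List.Relation.Binary.Subset.Propositional using (_⊆_)
open import Data.List.Membership.Propositional using (_∈_; _─_)
open import Data.List.Membership.Propositional.Properties
  using (∈-map⁺; ∈-map⁻; ∈-deduplicate⁺; ∈-deduplicate⁻; ∈-lookup)
open import Data.Product using (∃; _×_; _,_; proj₁; proj₂)
open import Data.Sum using (_⊎_; inj₁; inj₂)
open import Data.Empty using (⊥-elim)
open import Relation.Nullary using (yes; no)
open import Relation.Nullary.Decidable using (decidable-stable)
open import Relation.Binary.Definitions using (DecidableEquality)
open import Relation.Binary.PropositionalEquality
  using (_≡_; _≢_; refl; sym; trans; cong; subst)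
open import Relation.Binary.Construct.Closure.ReflexiveTransitive using (ε; _◅_)

-- Finite sets are represented by lists; only membership matters, except
-- that `Unique` lists count their elements exactly.
module _ {a} {A : Set a} where

  length-─ : ∀ {x} {xs : List A} (x∈xs : x ∈ xs) → length xs ≡ suc (length (xs ─ x∈xs))
  length-─ {xs = xs} x∈xs = length-removeAt′ xs (index x∈xs)

  ∈-─ : ∀ {x y} {xs : List A} (x∈xs : x ∈ xs) → y ∈ xs → y ≢ x → y ∈ xs ─ x∈xs
  ∈-─ (here refl) (here refl) y≢x = ⊥-elim (y≢x refl)
  ∈-─ (here refl) (there y∈xs) _ = y∈xs
  ∈-─ (there x∈xs) (here refl) _ = here refl
  ∈-─ (there x∈xs) (there y∈xs) y≢x = there (∈-─ x∈xs y∈xs y≢x)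

  unique-⊆⇒length-≤ : ∀ {xs ys : List A} → Unique ys → ys ⊆ xs → length ys ≤ length xs
  unique-⊆⇒length-≤ {ys = []} _ _ = z≤n
  unique-⊆⇒length-≤ {xs} {y ∷ ys} (y∉ys ∷ ys-unique) ys⊆xs = begin
    suc (length ys)          ≤⟨ s≤s (unique-⊆⇒length-≤ ys-unique ys⊆rest) ⟩
    suc (length (xs ─ y∈xs)) ≡⟨ sym (length-─ y∈xs) ⟩
    length xs                ∎
    where
    open ≤-Reasoning
    y∈xs : y ∈ xs
    y∈xs = ys⊆xs (here refl)
    ys⊆rest : ys ⊆ xs ─ y∈xs
    ys⊆rest z∈ys = ∈-─ y∈xs (ys⊆xs (there z∈ys)) (λ z≡y → All.lookup y∉ys z∈ys (sym z≡y))

-- A map sending xs onto a duplicate-free list ys with length xs ≤ length ys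
-- is injective on xs: identifying two elements would let the shorter list
-- xs ─ x' still cover ys.
surjective⇒injective : ∀ {A B : Set} → DecidableEquality A → (f : A → B) {xs : List A} {ys : List B} →
  Unique ys → ys ⊆ map f xs → length xs ≤ length ys →
  ∀ {x x'} → x ∈ xs → x' ∈ xs → f x ≡ f x' → x ≡ x'
surjective⇒injective _≟_ f {xs} {ys} ys-unique onto xs≤ys {x} {x'} x∈xs x'∈xs fx≡fx' =
  decidable-stable (x ≟ x') λ x≢x' → <-irrefl refl (begin-strict
    length ys                    ≤⟨ unique-⊆⇒length-≤ ys-unique (onto-rest x≢x') ⟩
    length (map f (xs ─ x'∈xs))  ≡⟨ length-map f (xs ─ x'∈xs) ⟩
    length (xs ─ x'∈xs)          <⟨ s≤s ≤-refl ⟩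
    suc (length (xs ─ x'∈xs))    ≡⟨ sym (length-─ x'∈xs) ⟩
    length xs                    ≤⟨ xs≤ys ⟩
    length ys                    ∎)
  where
  open ≤-Reasoning
  onto-rest : x ≢ x' → ys ⊆ map f (xs ─ x'∈xs)
  onto-rest x≢x' z∈ys with ∈-map⁻ f (onto z∈ys)
  ... | w , w∈xs , refl with w ≟ x'
  ...   | yes refl = subst (_∈ map f (xs ─ x'∈xs)) fx≡fx' (∈-map⁺ f (∈-─ x'∈xs x∈xs x≢x'))
  ...   | no w≢x'  = ∈-map⁺ f (∈-─ x'∈xs w∈xs w≢x')

module Distinct {A : Set} (_≟_ : DecidableEquality A) where

  distinct : List A → List A
  distinct = deduplicate _≟_

  #distinct : List A → ℕ
  #distinct xs = length (distinct xs)

  #distinct-mono : ∀ {xs ys} → xs ⊆ ys → #distinct xs ≤ #distinct ys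
  #distinct-mono {xs} xs⊆ys = unique-⊆⇒length-≤ (deduplicate-! _≟_ xs)
    (λ z∈ → ∈-deduplicate⁺ _≟_ (xs⊆ys (∈-deduplicate⁻ _≟_ xs z∈)))

  Functional : {T : Set} → (T → A) → (T → A) → List T → Set
  Functional k v ts = ∀ {t u} → t ∈ ts → u ∈ ts → k t ≡ k u → v t ≡ v u

  module _ {T : Set} (k v : T → A) (ts : List T) (k→v : Functional k v ts) where

    induced : A → A
    induced a with any? (λ t → k t ≟ a) ts
    ... | yes found = v (Any.lookup found)
    ... | no _      = a

    -- Since k → v holds, any tuple with key k t has the v-value of t.
    induced-correct : ∀ {t} → t ∈ ts → induced (k t) ≡ v t
    induced-correct {t} t∈ts with any? (λ u → k u ≟ k t) ts
    ... | yes found = k→v (∈-lookup (index found)) t∈ts (lookup-result found)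
    ... | no none = ⊥-elim (none (Any.map (λ { refl → refl }) t∈ts))

    induced-onto : distinct (map v ts) ⊆ map induced (distinct (map k ts))
    induced-onto z∈ with ∈-map⁻ v (∈-deduplicate⁻ _≟_ (map v ts) z∈)
    ... | t , t∈ts , refl = subst (_∈ map induced (distinct (map k ts))) (induced-correct t∈ts)
                              (∈-map⁺ induced (∈-deduplicate⁺ _≟_ (∈-map⁺ k t∈ts)))

    #distinct-fd : #distinct (map v ts) ≤ #distinct (map k ts)
    #distinct-fd = subst (#distinct (map v ts) ≤_) (length-map induced (distinct (map k ts)))
      (unique-⊆⇒length-≤ (deduplicate-! _≟_ (map v ts)) induced-onto)

    fd-reverse : #distinct (map k ts) ≤ #distinct (map v ts) → Functional v k ts
    fd-reverse k≤v t∈ts u∈ts vt≡vu =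
      surjective⇒injective _≟_ induced (deduplicate-! _≟_ (map v ts)) induced-onto k≤v
        (∈-deduplicate⁺ _≟_ (∈-map⁺ k t∈ts)) (∈-deduplicate⁺ _≟_ (∈-map⁺ k u∈ts))
        (trans (induced-correct t∈ts) (trans vt≡vu (sym (induced-correct u∈ts))))

module Counting (nR : ℕ) (arity : Fin nR → ℕ) where
  open Schema nR arity renaming (_⊆_ to _⊆ᵁ_)
  open Distinct ℕ._≟_

  -- Positions and UIDs have decidable equality (used to argue by cases on
  -- whether an SCC is a singleton).
  _≟ᴾ_ : DecidableEquality Pos
  (R ^ p) ≟ᴾ (S ^ q) with R Fin.≟ S
  ... | no R≢S = no (λ e → R≢S (cong rel e))
  ... | yes refl with p Fin.≟ q
  ...   | yes refl = yes refl
  ...   | no p≢q   = no (λ { refl → p≢q refl })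

  _≟ᵁ_ : DecidableEquality UID
  (a ⊆ᵁ b) ≟ᵁ (c ⊆ᵁ d) with a ≟ᴾ c | b ≟ᴾ d
  ... | yes refl | yes refl = yes refl
  ... | no a≢c   | _        = no (λ e → a≢c (cong src e))
  ... | _        | no b≢d   = no (λ e → b≢d (cong tgt e))

  tuples : (R : Fin nR) → Instance → List (Vec ℕ (arity R))
  tuples R [] = []
  tuples R ((S , u) ∷ I) with S Fin.≟ R
  ... | yes refl = u ∷ tuples R I
  ... | no _     = tuples R I

  ∈-tuples⁺ : ∀ {R t} I → (R , t) ∈ I → t ∈ tuples R I
  ∈-tuples⁺ {R} ((S , u) ∷ I) Rt∈I with S Fin.≟ R
  ∈-tuples⁺ (_ ∷ I) (here refl) | yes refl = here refl
  ∈-tuples⁺ (_ ∷ I) (there Rt∈I) | yes refl = there (∈-tuples⁺ I Rt∈I)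
  ∈-tuples⁺ (_ ∷ I) (here refl) | no S≢R = ⊥-elim (S≢R refl)
  ∈-tuples⁺ (_ ∷ I) (there Rt∈I) | no _ = ∈-tuples⁺ I Rt∈I

  ∈-tuples⁻ : ∀ {R t} I → t ∈ tuples R I → (R , t) ∈ I
  ∈-tuples⁻ {R} ((S , u) ∷ I) t∈ with S Fin.≟ R
  ∈-tuples⁻ (_ ∷ I) (here refl) | yes refl = here refl
  ∈-tuples⁻ (_ ∷ I) (there t∈)  | yes refl = there (∈-tuples⁻ I t∈)
  ∈-tuples⁻ (_ ∷ I) t∈          | no _     = there (∈-tuples⁻ I t∈)

  column : Instance → Pos → List ℕ
  column I (R ^ p) = map (λ t → lookup t p) (tuples R I)

  card : Instance → Pos → ℕ
  card I a = #distinct (column I a)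

  Column-FD : Instance → UFD → Set
  Column-FD I (fd R i j) = Functional (λ t → lookup t i) (λ t → lookup t j) (tuples R I)

  ufd⇒column-fd : ∀ I φ → SatUFD I φ → Column-FD I φ
  ufd⇒column-fd I (fd R i j) sat t∈ u∈ = sat _ _ (∈-tuples⁻ I t∈) (∈-tuples⁻ I u∈)

  column-fd⇒ufd : ∀ I φ → Column-FD I φ → SatUFD I φ
  column-fd⇒ufd I (fd R i j) k→v t u Rt∈I Ru∈I = k→v (∈-tuples⁺ I Rt∈I) (∈-tuples⁺ I Ru∈I)

  uid-card : ∀ I a b → SatUID I (a ⊆ᵁ b) → card I a ≤ card I b
  uid-card I (R ^ p) (S ^ q) sat = #distinct-mono column-⊆
    where
    column-⊆ : column I (R ^ p) ⊆ column I (S ^ q)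
    column-⊆ x∈ with ∈-map⁻ (λ t → lookup t p) x∈
    ... | t , t∈ , refl with sat t (∈-tuples⁻ I t∈)
    ...   | u , Su∈I , u[q]≡t[p] =
      subst (_∈ column I (S ^ q)) u[q]≡t[p] (∈-map⁺ (λ t → lookup t q) (∈-tuples⁺ I Su∈I))

  ufd-card : ∀ I R i j → SatUFD I (fd R i j) → card I (R ^ j) ≤ card I (R ^ i)
  ufd-card I R i j sat = #distinct-fd _ _ _ (ufd⇒column-fd I (fd R i j) sat)

  ufd-reverse : ∀ I R i j → SatUFD I (fd R i j) → card I (R ^ i) ≤ card I (R ^ j) →
                SatUFD I (fd R j i)
  ufd-reverse I R i j sat i≤j =
    column-fd⇒ufd I (fd R j i) (fd-reverse _ _ _ (ufd⇒column-fd I (fd R i j) sat) i≤j)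

  module Dependencies (ΣUID : UID → Set) (ΣUFD : UFD → Set) where
    open Deps ΣUID ΣUFD

    module InModel (I : Instance) (I⊨Σ : SatAll I) where

      uid-≤ : ∀ {τ} → ΣUID τ → card I (src τ) ≤ card I (tgt τ)
      uid-≤ {a ⊆ᵁ b} τ∈Σ = uid-card I a b (proj₁ I⊨Σ _ τ∈Σ)

      ufd-≥ : ∀ {a b} → InUFD a b → card I b ≤ card I a
      ufd-≥ (fd R i j , φ∈Σ , refl , refl) = ufd-card I R i j (proj₂ I⊨Σ _ φ∈Σ)

      edge-≤ : ∀ {τ τ'} → Edge τ τ' → card I (tgt τ) ≤ card I (src τ')
      edge-≤ (_ , _ , _ , φ) = ufd-≥ φ

      edge-≤-tgt : ∀ {τ τ'} → Edge τ τ' → card I (tgt τ) ≤ card I (tgt τ')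
      edge-≤-tgt e@(_ , τ'∈Σ , _ , _) = ≤-trans (edge-≤ e) (uid-≤ τ'∈Σ)

      reach-≤ : ∀ {τ τ'} → Reach τ τ' → card I (tgt τ) ≤ card I (tgt τ')
      reach-≤ ε = ≤-refl
      reach-≤ (e ◅ r) = ≤-trans (edge-≤-tgt e) (reach-≤ r)

      path-≤-src : ∀ {τ μ τ'} → Edge τ μ → Reach μ τ' → card I (tgt τ) ≤ card I (src τ')
      path-≤-src e ε = edge-≤ e
      path-≤-src e (e' ◅ r) = ≤-trans (edge-≤-tgt e) (path-≤-src e' r)

      module SCC (P : UID → Set) (P-scc : IsSCC P) (P-nontrivial : NonTrivial P) where

        P⊆Σ : ∀ {τ} → P τ → ΣUID τ
        P⊆Σ = proj₁ P-scc _

        connected : ∀ {τ τ'} → P τ → P τ' → Reach τ τ'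
        connected = proj₁ (proj₂ P-scc) _ _

        -- A second member τ' of P gives a cycle τ ↣* τ' ↣⁺ τ.
        cycle-≤ : ∀ {τ τ'} → P τ → P τ' → τ' ≢ τ → card I (tgt τ) ≤ card I (src τ)
        cycle-≤ {τ} {τ'} τ∈P τ'∈P τ'≢τ with connected τ'∈P τ∈P
        ... | ε     = ⊥-elim (τ'≢τ refl)
        ... | e ◅ r = ≤-trans (reach-≤ (connected τ∈P τ'∈P)) (path-≤-src e r)

        -- Either P has a second member, or P = {τ} and τ ↣ τ: in both cases
        -- the target of τ has no more values than its source.  (Stated by
        -- contradiction, since membership in P is not decidable.)
        tgt-≤-src : ∀ {τ} → P τ → card I (tgt τ) ≤ card I (src τ)
        tgt-≤-src {τ} τ∈P = decidable-stable (card I (tgt τ) ≤? card I (src τ)) λ tgt≰src →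
          let singleton : ∀ τ' → P τ' → τ' ≡ τ
              singleton τ' τ'∈P = decidable-stable (τ' ≟ᵁ τ) λ τ'≢τ →
                tgt≰src (cycle-≤ τ∈P τ'∈P τ'≢τ)
          in tgt≰src (edge-≤ (P-nontrivial τ τ∈P singleton))

        position-card : ∀ {τ c} → P τ → (src τ ≡ c) ⊎ (tgt τ ≡ c) → card I c ≡ card I (tgt τ)
        position-card τ∈P (inj₁ refl) = ≤-antisym (uid-≤ (P⊆Σ τ∈P)) (tgt-≤-src τ∈P)
        position-card τ∈P (inj₂ refl) = refl

        pos-card-≤ : ∀ {a b} → InPos P a → InPos P b → card I a ≤ card I b
        pos-card-≤ {a} {b} (τ , τ∈P , τ∋a) (τ' , τ'∈P , τ'∋b) = begin
          card I a        ≡⟨ position-card τ∈P τ∋a ⟩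
          card I (tgt τ)  ≤⟨ reach-≤ (connected τ∈P τ'∈P) ⟩
          card I (tgt τ') ≡⟨ sym (position-card τ'∈P τ'∋b) ⟩
          card I b        ∎
          where open ≤-Reasoning

    ufd-symmetric : Closed → (P : UID → Set) → IsSCC P → NonTrivial P →
      ∀ {a b} → InPos P a → InPos P b → InUFD a b → InUFD b a
    ufd-symmetric closed P P-scc P-nontrivial a∈P b∈P (fd R i j , φ∈Σ , refl , refl) =
      fd R j i , proj₂ closed _ implied , refl , refl
      where
      implied : FinImpliesUFD (fd R j i)
      implied I I⊨Σ = ufd-reverse I R i j (proj₂ I⊨Σ _ φ∈Σ) (pos-card-≤ a∈P b∈P)
        where open InModel I I⊨Σ
              open SCC P P-scc P-nontrivial

mainTheorem14 : (nR : ℕ) (arity : Fin nR → ℕ) →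
    let open Schema nR arity in
    (ΣUID : UID → Set) (ΣUFD : UFD → Set) →
    let open Deps ΣUID ΣUFD in
    WellFormed → Closed →
    (P : UID → Set) → IsSCC P → NonTrivial P →
    (a b : Pos) → InPos P a → InPos P b → a ≢ b →
    InUFD a b → InUFD b a
mainTheorem14 nR arity ΣUID ΣUFD _ closed P P-scc P-nontrivial _ _ a∈P b∈P _ =
  Counting.Dependencies.ufd-symmetric nR arity ΣUID ΣUFD closed P P-scc P-nontrivial a∈P b∈P
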